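{- Let $F$ be a forest, and consider a play of the Sweller-start competition-independence game on $F$ in which Sweller follows the greedy strategy described in the context and Diminisher plays arbitrarily; let $N$ be the total number of moves and $r = \lfloor N/2 \rfloor$. Let $i \leq r$ and suppose $v_i^D(w_i^D) = 1+l$ and $e_i^D(w_i^D) = l+p$ for some $l \geq 1$. Then there is $\hat{w}_i^S \in V(F_{i-1}^D)$ such that either $v_i^S(\hat{w}_i^S) = q+2$, $e_i^S(\hat{w}_i^S) \geq q+l$ and $k_i^S(\hat{w}_i^S) \geq l-p-2$ for some $q \leq \lfloor p/l \rfloor$, or $v_i^S(\hat{w}_i^S) = q+3$, $e_i^S(\hat{w}_i^S) \geq q+l+2$ and $k_i^S(\hat{w}_i^S) \geq l-p-1$ for some $q \leq \lfloor p/l \rfloor$.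
   Context: The game is rephrased as follows: starting from the forest $F$, players alternately pick a vertex $u$ of the current forest $H$ and replace $H$ by $H - N_H[u]$; Sweller moves first and the game ends when the forest is empty. For a graph $G$, $K(G)$ is its number of isolated vertices. Set $F_0^D = F$. For $i \geq 1$, Sweller's $i$-th move is a vertex $w_i^S$ of $F_{i-1}^D$ and $F_i^S = F_{i-1}^D - N[w_i^S]$; Diminisher's $i$-th move is a vertex $w_i^D$ of $F_i^S$ and $F_i^D = F_i^S - N[w_i^D]$. For $u \in V(F_{i-1}^D)$ define $v_i^S(u) = |N_{F_{i-1}^D}[u]|$, $e_i^S(u) = |E(F_{i-1}^D)| - |E(F_{i-1}^D - N[u])|$, $k_i^S(u) = K(F_{i-1}^D - N[u]) - K(F_{i-1}^D)$, and $m_i^S(u) = (1-\beta)k_i^S(u) + v_i^S(u) - \alpha e_i^S(u)$ with $\alpha = 3/8$, $\beta = 13/8$. For $u \in V(F_i^S)$: $v_i^D(u) = |N_{F_i^S}[u]|$ and $e_i^D(u) = |E(F_i^S)| - |E(F_i^S - N[u])|$. The greedy strategy: at her $i$-th move Sweller picks any vertex $w_i^S$ of $F_{i-1}^D$ minimizing $m_i^S$. -}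

module Defs where

open import Data.Bool using (Bool; true; false; _∧_; _∨_; not; if_then_else_)
open import Data.Nat as ℕ using (ℕ; zero; suc; _+_)
open import Data.Integer as ℤ using (ℤ; +_)
open import Data.Rational as ℚ using (ℚ; 1ℚ)
open import Data.Fin using (Fin; _≟_; _<?_)
open import Data.List using (List; []; _∷_; _++_; [_]; allFin; foldl)
open import Data.List.Relation.Unary.Linked using (Linked)
open import Data.List.Relation.Unary.Unique.Propositional using (Unique)
open import Data.Product using (Σ; _×_)
open import Data.Empty using (⊥)
open import Relation.Nullary using (¬_; does)
open import Relation.Binary.PropositionalEquality using (_≡_)

record Graph (n : ℕ) : Set where
  field
    adj    : Fin n → Fin n → Bool
    sym    : ∀ u v → adj u v ≡ adj v u
    irrefl : ∀ u → adj u u ≡ false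
open Graph public

IsCycle : ∀ {n} → Graph n → List (Fin n) → Set
IsCycle G [] = ⊥
IsCycle G (a ∷ []) = ⊥
IsCycle G (a ∷ b ∷ []) = ⊥
IsCycle G (a ∷ b ∷ c ∷ rest) =
  Unique (a ∷ b ∷ c ∷ rest) ×
  Linked (λ x y → adj G x y ≡ true) ((a ∷ b ∷ c ∷ rest) ++ [ a ])

IsForest : ∀ {n} → Graph n → Set
IsForest G = ∀ c → ¬ IsCycle G c

-- Induced subgraphs of G, given by their vertex sets (Fin n → Bool)

VSet : ℕ → Set
VSet n = Fin n → Bool

full : ∀ {n} → VSet n
full _ = true

_∈V_ : ∀ {n} → Fin n → VSet n → Set
u ∈V H = H u ≡ true

IsEmpty : ∀ {n} → VSet n → Set
IsEmpty H = ∀ u → H u ≡ false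

sumOver : ∀ {A : Set} → (A → ℕ) → List A → ℕ
sumOver f [] = 0
sumOver f (x ∷ xs) = f x + sumOver f xs

count : ∀ {A : Set} → (A → Bool) → List A → ℕ
count P [] = 0
count P (x ∷ xs) = if P x then suc (count P xs) else count P xs

module _ {n : ℕ} (G : Graph n) where

  inN : VSet n → Fin n → Fin n → Bool
  inN H u v = H v ∧ (does (v ≟ u) ∨ adj G u v)

  remove : VSet n → Fin n → VSet n
  remove H u v = H v ∧ not (inN H u v)

  nbhdSize : VSet n → Fin n → ℕ
  nbhdSize H u = count (inN H u) (allFin n)

  edges : VSet n → ℕ
  edges H = sumOver (λ u → count (λ v → does (u <? v) ∧ H u ∧ H v ∧ adj G u v) (allFin n)) (allFin n)

  isolated : VSet n → Fin n → Bool
  isolated H v = H v ∧ (count (λ w → H w ∧ adj G v w) (allFin n) ℕ.≡ᵇ 0)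

  K : VSet n → ℕ
  K H = count (isolated H) (allFin n)

  vM : VSet n → Fin n → ℕ
  vM = nbhdSize

  -- e(u) = |E(H)| - |E(H - N[u])|   (a natural number, since E(H - N[u]) ⊆ E(H))
  eM : VSet n → Fin n → ℕ
  eM H u = edges H ℕ.∸ edges (remove H u)

  kM : VSet n → Fin n → ℤ
  kM H u = + K (remove H u) ℤ.- + K H

  α β : ℚ
  α = + 3 ℚ./ 8
  β = + 13 ℚ./ 8

  mM : VSet n → Fin n → ℚ
  mM H u = (1ℚ ℚ.- β) ℚ.* (kM H u ℚ./ 1) ℚ.+ (+ vM H u ℚ./ 1) ℚ.- α ℚ.* (+ eM H u ℚ./ 1)

  playAll : VSet n → List (Fin n) → VSet n
  playAll H ws = foldl remove H ws

  -- SwellerTurn H ws : it is Sweller's turn at H and ws is the rest of the play.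
  mutual
    data SwellerTurn : VSet n → List (Fin n) → Set where
      s-end  : ∀ {H} → IsEmpty H → SwellerTurn H []
      s-move : ∀ {H w ws} → w ∈V H →
               (∀ u → u ∈V H → mM H w ℚ.≤ mM H u) →
               DiminisherTurn (remove H w) ws → SwellerTurn H (w ∷ ws)

    data DiminisherTurn : VSet n → List (Fin n) → Set where
      d-end  : ∀ {H} → IsEmpty H → DiminisherTurn H []
      d-move : ∀ {H w ws} → w ∈V H →
               SwellerTurn (remove H w) ws → DiminisherTurn H (w ∷ ws)

  GreedyPlay : List (Fin n) → Set
  GreedyPlay ws = SwellerTurn full ws

-- Let H′ = H − N[w^S] and let Γ be the l neighbours of w^D in H′; they are pairwise
-- non-adjacent because F has no triangle.  Of the l + p edges removed by w^D, l form the star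
-- at w^D and the others join Γ to B = H′ − N[w^D], so at most p edges join Γ to B.  Take for
-- ŵ the vertex of Γ with the fewest, q, neighbours in B; then q l ≤ p.  In H the vertex ŵ
-- has these q neighbours, w^D, and at most one neighbour in N[w^S] (two would close a
-- 4-cycle through w^S), whence v = q + 2 or q + 3.  Playing ŵ deletes its own edges and the
-- other l − 1 edges at w^D, and in the second case also the edge from its neighbour in N[w^S]
-- to w^S.  Finally, a vertex of Γ − ŵ with no neighbour in B and none in N[w^S] becomes
-- isolated; at most p vertices of Γ have a neighbour in B, and at most one has a neighbour in
-- N[w^S] (else a 4- or 6-cycle), which gives the bound on k.

module Submission where

open import Defs hiding (sym)
open Graph using () renaming (sym to adj-sym)
open import Data.Bool using (Bool; true; false; _∧_; _∨_; not; if_then_else_)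
open import Data.Bool.Properties using (∧-zeroʳ; ∨-zeroʳ; not-¬; ¬-not) renaming (_≟_ to _≟𝔹_)
open import Data.Nat using (ℕ; zero; suc; _+_; _*_; _∸_; _≤_; _≥_; z≤n; s≤s; _≡ᵇ_; ⌊_/2⌋; _/_; NonZero; >-nonZero)
open import Data.Nat.Properties hiding (_≟_; _<?_; <-cmp)
open import Data.Nat.Properties using () renaming (_≟_ to _≟ℕ_)
open import Data.Nat.DivMod using (m*n/n≡m; /-monoˡ-≤)
open import Data.Nat.Tactic.RingSolver using (solve-∀)
open import Algebra.Properties.CommutativeSemigroup +-commutativeSemigroup using (interchange)
open import Data.Integer as ℤ using (ℤ; +_)
import Data.Integer.Properties as ℤP
import Data.Integer.Tactic.RingSolver as ℤSolver
open import Data.Fin as Fin using (Fin; _≟_; _<?_)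
open import Data.Fin.Properties using (<-cmp)
open import Data.List using (List; []; _∷_; _++_; length; allFin; tabulate; filter)
open import Data.List.Membership.Propositional using (_∈_)
open import Data.List.Membership.Propositional.Properties using (∈-allFin; ∈-filter⁺)
open import Data.List.Relation.Unary.Any using (here; there)
import Data.List.Relation.Unary.All as All
open import Data.List.Relation.Unary.All using ([]; _∷_)
open import Data.List.Relation.Unary.All.Properties using (all-filter)
open import Data.List.Relation.Unary.AllPairs using ([]; _∷_)
open import Data.List.Relation.Unary.Linked using ([-]; _∷_)
open import Data.List.Extrema.Nat using (argmin; f[argmin]≤f[xs]; argmin-all)
open import Data.Product using (Σ; _×_; _,_; proj₁; proj₂)
open import Data.Sum using (_⊎_; inj₁; inj₂)
open import Data.Empty using (⊥; ⊥-elim)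
open import Relation.Nullary using (¬_; Dec; does; yes; no)
open import Relation.Nullary.Decidable using (dec-true; dec-false)
open import Relation.Binary using (tri<; tri≈; tri>)
open import Relation.Binary.PropositionalEquality
open import Function using (_∘_)

∧-true⁺ : ∀ {a b} → a ≡ true → b ≡ true → a ∧ b ≡ true
∧-true⁺ refl refl = refl

∧-trueˡ : ∀ {a b} → a ∧ b ≡ true → a ≡ true
∧-trueˡ {true} _ = refl

∧-trueʳ : ∀ {a b} → a ∧ b ≡ true → b ≡ true
∧-trueʳ {true} e = e

not-true⁻ : ∀ {a} → not a ≡ true → a ≡ false
not-true⁻ {false} _ = refl

∨-true⁻ : ∀ {a b} → a ∨ b ≡ true → a ≡ true ⊎ b ≡ true
∨-true⁻ {true} _ = inj₁ refl
∨-true⁻ {false} e = inj₂ e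

dec-true⁻ : ∀ {P : Set} (d : Dec P) → does d ≡ true → P
dec-true⁻ (yes p) _ = p

separated : ∀ {A : Set} (P : A → Bool) {a b} → P a ≡ true → P b ≡ false → ¬ a ≡ b
separated P pa pb refl = not-¬ pa pb

≡ᵇ0⁻ : ∀ {k} → (k ≡ᵇ 0) ≡ true → k ≡ 0
≡ᵇ0⁻ {zero} _ = refl

≡ᵇ0⁺ : ∀ {k} → k ≡ 0 → (k ≡ᵇ 0) ≡ true
≡ᵇ0⁺ refl = refl

≡ᵇ0-false : ∀ {k} → 1 ≤ k → (k ≡ᵇ 0) ≡ false
≡ᵇ0-false (s≤s _) = refl

𝟙 : Bool → ℕ
𝟙 true = 1
𝟙 false = 0

𝟙-∧ : ∀ a b → 𝟙 (a ∧ b) ≡ 𝟙 a * 𝟙 b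
𝟙-∧ false b = refl
𝟙-∧ true false = refl
𝟙-∧ true true = refl

𝟙-mono : ∀ {a b} → (a ≡ true → b ≡ true) → 𝟙 a ≤ 𝟙 b
𝟙-mono {false} _ = z≤n
𝟙-mono {true} h rewrite h refl = ≤-refl

𝟙-split : ∀ a d → (d ≡ true → a ≡ true) → 𝟙 a ≡ 𝟙 (a ∧ not d) + 𝟙 d
𝟙-split a true h rewrite h refl = refl
𝟙-split false false _ = refl
𝟙-split true false _ = refl

module _ {A : Set} where

  sumOver-cong : ∀ {f g : A → ℕ} xs → (∀ x → f x ≡ g x) → sumOver f xs ≡ sumOver g xs
  sumOver-cong [] h = refl
  sumOver-cong (x ∷ xs) h = cong₂ _+_ (h x) (sumOver-cong xs h)

  sumOver-+ : ∀ (f g : A → ℕ) xs → sumOver (λ x → f x + g x) xs ≡ sumOver f xs + sumOver g xs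
  sumOver-+ f g [] = refl
  sumOver-+ f g (x ∷ xs) rewrite sumOver-+ f g xs = interchange (f x) (g x) _ _

  sumOver-mono : ∀ {f g : A → ℕ} xs → (∀ x → f x ≤ g x) → sumOver f xs ≤ sumOver g xs
  sumOver-mono [] h = z≤n
  sumOver-mono (x ∷ xs) h = +-mono-≤ (h x) (sumOver-mono xs h)

  sumOver-zero : ∀ (xs : List A) → sumOver (λ _ → 0) xs ≡ 0
  sumOver-zero [] = refl
  sumOver-zero (x ∷ xs) = sumOver-zero xs

  sumOver-∈ : ∀ (f : A → ℕ) {a} {xs} → a ∈ xs → f a ≤ sumOver f xs
  sumOver-∈ f (here refl) = m≤m+n _ _
  sumOver-∈ f (there a∈xs) = ≤-trans (sumOver-∈ f a∈xs) (m≤n+m _ _)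

  count≡sumOver-𝟙 : ∀ (P : A → Bool) xs → count P xs ≡ sumOver (𝟙 ∘ P) xs
  count≡sumOver-𝟙 P [] = refl
  count≡sumOver-𝟙 P (x ∷ xs) with P x
  ... | true = cong suc (count≡sumOver-𝟙 P xs)
  ... | false = count≡sumOver-𝟙 P xs

  count-cong : ∀ {P Q : A → Bool} xs → (∀ x → P x ≡ Q x) → count P xs ≡ count Q xs
  count-cong [] h = refl
  count-cong {P} {Q} (x ∷ xs) h rewrite h x with Q x
  ... | true = cong suc (count-cong xs h)
  ... | false = count-cong xs h

  count-mono : ∀ {P Q : A → Bool} xs → (∀ x → P x ≡ true → Q x ≡ true) → count P xs ≤ count Q xs
  count-mono {P} {Q} xs h =
    subst₂ _≤_ (sym (count≡sumOver-𝟙 P xs)) (sym (count≡sumOver-𝟙 Q xs))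
      (sumOver-mono xs (λ x → 𝟙-mono (h x)))

  count-split : ∀ (P Q : A → Bool) xs →
    count P xs ≡ count (λ x → P x ∧ Q x) xs + count (λ x → P x ∧ not (Q x)) xs
  count-split P Q [] = refl
  count-split P Q (x ∷ xs) with P x | Q x
  ... | true | true = cong suc (count-split P Q xs)
  ... | true | false = trans (cong suc (count-split P Q xs)) (sym (+-suc _ _))
  ... | false | _ = count-split P Q xs

  count-∨ : ∀ (P Q : A → Bool) xs → count (λ x → P x ∨ Q x) xs ≤ count P xs + count Q xs
  count-∨ P Q [] = z≤n
  count-∨ P Q (x ∷ xs) with P x | Q x
  ... | true | true = s≤s (≤-trans (count-∨ P Q xs) (+-monoʳ-≤ (count P xs) (n≤1+n _)))
  ... | true | false = s≤s (count-∨ P Q xs)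
  ... | false | true = ≤-trans (s≤s (count-∨ P Q xs)) (≤-reflexive (sym (+-suc _ _)))
  ... | false | false = count-∨ P Q xs

  count-∈ : ∀ (P : A → Bool) {a} {xs} → a ∈ xs → P a ≡ true → 1 ≤ count P xs
  count-∈ P {xs = x ∷ xs} (here refl) pa rewrite pa = s≤s z≤n
  count-∈ P {xs = x ∷ xs} (there a∈xs) pa with P x
  ... | true = s≤s z≤n
  ... | false = count-∈ P a∈xs pa

  count≡0⇒false : ∀ (P : A → Bool) {a} {xs} → count P xs ≡ 0 → a ∈ xs → P a ≡ false
  count≡0⇒false P c≡0 a∈xs = ¬-not λ pa → n≮0 (subst (1 ≤_) c≡0 (count-∈ P a∈xs pa))

  count≢0⇒witness : ∀ (P : A → Bool) xs → ¬ count P xs ≡ 0 → Σ A λ a → P a ≡ true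
  count≢0⇒witness P [] h = ⊥-elim (h refl)
  count≢0⇒witness P (x ∷ xs) h with P x in px
  ... | true = x , px
  ... | false = count≢0⇒witness P xs h

  sumOver-pair : ∀ (f : A → ℕ) {a b} {xs} → a ∈ xs → b ∈ xs → ¬ a ≡ b → f a + f b ≤ sumOver f xs
  sumOver-pair f (here refl) (here refl) a≢b = ⊥-elim (a≢b refl)
  sumOver-pair f (here refl) (there b∈xs) _ = +-monoʳ-≤ _ (sumOver-∈ f b∈xs)
  sumOver-pair f {a} {b} (there a∈xs) (here refl) _ =
    ≤-trans (≤-reflexive (+-comm (f a) (f b))) (+-monoʳ-≤ (f b) (sumOver-∈ f a∈xs))
  sumOver-pair f (there a∈xs) (there b∈xs) a≢b = ≤-trans (sumOver-pair f a∈xs b∈xs a≢b) (m≤n+m _ _)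

  count-const-false : ∀ (xs : List A) → count (λ _ → false) xs ≡ 0
  count-const-false [] = refl
  count-const-false (x ∷ xs) = count-const-false xs

sumOver-swap : ∀ {A B : Set} (f : A → B → ℕ) xs ys →
  sumOver (λ x → sumOver (f x) ys) xs ≡ sumOver (λ y → sumOver (λ x → f x y) xs) ys
sumOver-swap f [] ys = sym (sumOver-zero ys)
sumOver-swap f (x ∷ xs) ys =
  trans (cong (_+_ (sumOver (f x) ys)) (sumOver-swap f xs ys)) (sym (sumOver-+ (f x) _ ys))

count-tabulate : ∀ {A : Set} {n} (P : A → Bool) (f : Fin n → A) →
  count P (tabulate f) ≡ count (P ∘ f) (allFin n)
count-tabulate {n = zero} P f = refl
count-tabulate {n = suc n} P f
  rewrite count-tabulate P (f ∘ Fin.suc) | count-tabulate (P ∘ f) Fin.suc with P (f Fin.zero)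
... | true = refl
... | false = refl

count-≟ : ∀ {n} (b : Fin n) → count (λ u → does (u ≟ b)) (allFin n) ≡ 1
count-≟ {suc n} Fin.zero =
  cong suc (trans (count-tabulate {n = n} (λ u → does (u ≟ Fin.zero)) Fin.suc) (count-const-false (allFin n)))
count-≟ {suc n} (Fin.suc b) =
  trans (count-tabulate {n = n} (λ u → does (u ≟ Fin.suc b)) Fin.suc) (trans (count-cong (allFin n) suc≟suc) (count-≟ b))
  where suc≟suc : ∀ u → does (Fin.suc u ≟ Fin.suc b) ≡ does (u ≟ b)
        suc≟suc u with u ≟ b
        ... | yes _ = refl
        ... | no _ = refl

ℤ-rearrange : ∀ a b l p c → b + l ≤ a + p + c → + l ℤ.- + p ℤ.- + c ℤ.≤ + a ℤ.- + b
ℤ-rearrange a b l p c h = subst₂ ℤ._≤_ (sym lhs) (sym rhs) (ℤP.+-monoˡ-≤ (ℤ.- m) (ℤ.+≤+ h))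
  where
    m : ℤ
    m = + b ℤ.+ + p ℤ.+ + c
    lhs : + l ℤ.- + p ℤ.- + c ≡ + (b + l) ℤ.- m
    lhs = trans (lemma (+ l) (+ p) (+ c) (+ b)) (cong (ℤ._- m) (sym (ℤP.pos-+ b l)))
      where lemma : ∀ (l p c b : ℤ) → l ℤ.- p ℤ.- c ≡ (b ℤ.+ l) ℤ.- (b ℤ.+ p ℤ.+ c)
            lemma = ℤSolver.solve-∀
    rhs : + a ℤ.- + b ≡ + (a + p + c) ℤ.- m
    rhs = trans (lemma (+ a) (+ p) (+ c) (+ b))
                (cong (ℤ._- m) (sym (trans (ℤP.pos-+ (a + p) c) (cong (ℤ._+ + c) (ℤP.pos-+ a p)))))
      where lemma : ∀ (a p c b : ℤ) → a ℤ.- b ≡ (a ℤ.+ p ℤ.+ c) ℤ.- (b ℤ.+ p ℤ.+ c)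
            lemma = ℤSolver.solve-∀

module Induced {n : ℕ} (G : Graph n) where

  V : List (Fin n)
  V = allFin n

  _∖_ : VSet n → VSet n → VSet n
  (A ∖ D) v = A v ∧ not (D v)

  deg : VSet n → Fin n → ℕ
  deg X u = count (λ w → X w ∧ adj G u w) V

  sumOn : VSet n → (Fin n → ℕ) → ℕ
  sumOn D f = sumOver (λ u → if D u then f u else 0) V

  cross : VSet n → VSet n → ℕ
  cross D B = sumOn D (deg B)

  pairSum : (Fin n → Fin n → ℕ) → ℕ
  pairSum f = sumOver (λ u → sumOver (f u) V) V

  lt : Fin n → Fin n → Bool
  lt u v = does (u <? v)

  edgesBetween : VSet n → VSet n → ℕ
  edgesBetween X Y = pairSum (λ u v → 𝟙 (lt u v) * (𝟙 (X u) * (𝟙 (Y v) * 𝟙 (adj G u v))))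

  pairSum-cong : ∀ {f g : Fin n → Fin n → ℕ} → (∀ u v → f u v ≡ g u v) → pairSum f ≡ pairSum g
  pairSum-cong h = sumOver-cong V (λ u → sumOver-cong V (h u))

  pairSum-+ : ∀ (f g : Fin n → Fin n → ℕ) → pairSum (λ u v → f u v + g u v) ≡ pairSum f + pairSum g
  pairSum-+ f g = trans (sumOver-cong V (λ u → sumOver-+ (f u) (g u) V)) (sumOver-+ _ _ V)

  deg≡sumOver : ∀ X u → deg X u ≡ sumOver (λ w → 𝟙 (X w) * 𝟙 (adj G u w)) V
  deg≡sumOver X u = trans (count≡sumOver-𝟙 _ V) (sumOver-cong V (λ w → 𝟙-∧ (X w) _))

  edges≡edgesBetween : ∀ X → edges G X ≡ edgesBetween X X
  edges≡edgesBetween X = sumOver-cong V λ u → trans (count≡sumOver-𝟙 _ V) (sumOver-cong V λ v →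
    trans (𝟙-∧ (lt u v) _) (cong (𝟙 (lt u v) *_) (trans (𝟙-∧ (X u) _) (cong (𝟙 (X u) *_) (𝟙-∧ (X v) _)))))

  cross≡pairSum : ∀ D B → cross D B ≡ pairSum (λ u v → 𝟙 (D u) * (𝟙 (B v) * 𝟙 (adj G u v)))
  cross≡pairSum D B = sumOver-cong V summand
    where
      summand : ∀ u → (if D u then deg B u else 0) ≡ sumOver (λ v → 𝟙 (D u) * (𝟙 (B v) * 𝟙 (adj G u v))) V
      summand u with D u
      ... | true = trans (deg≡sumOver B u) (sumOver-cong V (λ v → sym (*-identityˡ _)))
      ... | false = sym (sumOver-zero V)

  𝟙-lt-trichotomy : ∀ {u v} → ¬ u ≡ v → 𝟙 (lt u v) + 𝟙 (lt v u) ≡ 1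
  𝟙-lt-trichotomy {u} {v} u≢v with <-cmp u v
  ... | tri< u<v _ v≮u rewrite dec-true (u <? v) u<v | dec-false (v <? u) v≮u = refl
  ... | tri≈ _ u≡v _ = ⊥-elim (u≢v u≡v)
  ... | tri> u≮v _ v<u rewrite dec-false (u <? v) u≮v | dec-true (v <? u) v<u = refl

  cross≡edgesBetween : ∀ D B → cross D B ≡ edgesBetween D B + edgesBetween B D
  cross≡edgesBetween D B = begin
      cross D B
    ≡⟨ cross≡pairSum D B ⟩
      pairSum c
    ≡⟨ trans (pairSum-cong split-by-order) (pairSum-+ _ _) ⟩
      edgesBetween D B + pairSum (λ u v → 𝟙 (lt v u) * c u v)
    ≡⟨ cong (_+_ (edgesBetween D B)) (trans (sumOver-swap _ V V) (pairSum-cong flip)) ⟩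
      edgesBetween D B + edgesBetween B D
    ∎
    where
      open ≡-Reasoning
      c : Fin n → Fin n → ℕ
      c u v = 𝟙 (D u) * (𝟙 (B v) * 𝟙 (adj G u v))
      split-by-order : ∀ u v → c u v ≡ 𝟙 (lt u v) * c u v + 𝟙 (lt v u) * c u v
      split-by-order u v with u ≟ v
      ... | yes refl rewrite irrefl G u = lemma (𝟙 (D u)) (𝟙 (B u)) (𝟙 (lt u u))
        where lemma : ∀ x y z → x * (y * 0) ≡ z * (x * (y * 0)) + z * (x * (y * 0))
              lemma = solve-∀
      ... | no u≢v = begin
          c u v                                  ≡⟨ sym (*-identityˡ _) ⟩
          1 * c u v                              ≡⟨ cong (_* c u v) (sym (𝟙-lt-trichotomy u≢v)) ⟩
          (𝟙 (lt u v) + 𝟙 (lt v u)) * c u v      ≡⟨ *-distribʳ-+ (c u v) (𝟙 (lt u v)) (𝟙 (lt v u)) ⟩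
          𝟙 (lt u v) * c u v + 𝟙 (lt v u) * c u v ∎
      flip : ∀ u v → 𝟙 (lt u v) * c v u ≡ 𝟙 (lt u v) * (𝟙 (B u) * (𝟙 (D v) * 𝟙 (adj G u v)))
      flip u v rewrite adj-sym G v u = lemma (𝟙 (lt u v)) (𝟙 (D v)) (𝟙 (B u)) (𝟙 (adj G u v))
        where lemma : ∀ l d b e → l * (d * (b * e)) ≡ l * (b * (d * e))
              lemma = solve-∀

  edgesBetween-split : ∀ {A B D} → (∀ u → 𝟙 (A u) ≡ 𝟙 (B u) + 𝟙 (D u)) →
    edgesBetween A A ≡ edgesBetween B B + edgesBetween D D + (edgesBetween D B + edgesBetween B D)
  edgesBetween-split {A} {B} {D} split =
    trans (pairSum-cong expand)
      (trans (pairSum-+ _ _) (cong₂ _+_ (pairSum-+ _ _) (pairSum-+ _ _)))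
    where
      expand : ∀ u v →
        𝟙 (lt u v) * (𝟙 (A u) * (𝟙 (A v) * 𝟙 (adj G u v))) ≡
        𝟙 (lt u v) * (𝟙 (B u) * (𝟙 (B v) * 𝟙 (adj G u v))) + 𝟙 (lt u v) * (𝟙 (D u) * (𝟙 (D v) * 𝟙 (adj G u v))) +
        (𝟙 (lt u v) * (𝟙 (D u) * (𝟙 (B v) * 𝟙 (adj G u v))) + 𝟙 (lt u v) * (𝟙 (B u) * (𝟙 (D v) * 𝟙 (adj G u v))))
      expand u v rewrite split u | split v =
        lemma (𝟙 (lt u v)) (𝟙 (B u)) (𝟙 (D u)) (𝟙 (B v)) (𝟙 (D v)) (𝟙 (adj G u v))
        where lemma : ∀ l b d b′ d′ e → l * ((b + d) * ((b′ + d′) * e)) ≡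
                        l * (b * (b′ * e)) + l * (d * (d′ * e)) + (l * (d * (b′ * e)) + l * (b * (d′ * e)))
              lemma = solve-∀

  edges-split : ∀ A D → (∀ v → D v ≡ true → A v ≡ true) →
    edges G A ≡ edges G (A ∖ D) + edges G D + cross D (A ∖ D)
  edges-split A D D⊆A = begin
      edges G A
    ≡⟨ edges≡edgesBetween A ⟩
      edgesBetween A A
    ≡⟨ edgesBetween-split {A} {A ∖ D} {D} (λ u → 𝟙-split (A u) (D u) (D⊆A u)) ⟩
      edgesBetween (A ∖ D) (A ∖ D) + edgesBetween D D + (edgesBetween D (A ∖ D) + edgesBetween (A ∖ D) D)
    ≡⟨ sym (cong₂ _+_ (cong₂ _+_ (edges≡edgesBetween (A ∖ D)) (edges≡edgesBetween D)) (cross≡edgesBetween D (A ∖ D))) ⟩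
      edges G (A ∖ D) + edges G D + cross D (A ∖ D)
    ∎
    where open ≡-Reasoning

  ∈inN-adj : ∀ X c {v} → X v ≡ true → adj G c v ≡ true → inN G X c v ≡ true
  ∈inN-adj X c {v} xv a = ∧-true⁺ xv (trans (cong (does (v ≟ c) ∨_) a) (∨-zeroʳ _))

  ∈inN-centre : ∀ X c → X c ≡ true → inN G X c c ≡ true
  ∈inN-centre X c xc rewrite xc | dec-true (c ≟ c) refl = refl

  inN-cases : ∀ X c {v} → inN G X c v ≡ true → v ≡ c ⊎ adj G c v ≡ true
  inN-cases X c {v} e with ∨-true⁻ (∧-trueʳ {X v} e)
  ... | inj₁ v≟c = inj₁ (dec-true⁻ (v ≟ c) v≟c)
  ... | inj₂ a = inj₂ a

  ∈remove : ∀ X c {w} → X w ≡ true → ¬ w ≡ c → adj G c w ≡ false → remove G X c w ≡ true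
  ∈remove X c {w} xw w≢c a rewrite xw | dec-false (w ≟ c) w≢c | a = refl

  ∉remove : ∀ X c {w} → inN G X c w ≡ true → remove G X c w ≡ false
  ∉remove X c {w} e rewrite e = ∧-zeroʳ (X w)

  deg-mono : ∀ X Y v → (∀ w → X w ≡ true → Y w ≡ true) → deg X v ≤ deg Y v
  deg-mono X Y v X⊆Y = count-mono V (λ w e → ∧-true⁺ (X⊆Y w (∧-trueˡ e)) (∧-trueʳ {X w} e))

  count-≤1 : ∀ (P : VSet n) b → (∀ u → P u ≡ true → u ≡ b) → count P V ≤ 1
  count-≤1 P b only-b =
    ≤-trans (count-mono V (λ u pu → dec-true (u ≟ b) (only-b u pu))) (≤-reflexive (count-≟ b))

  count-atMostOne : ∀ (P : VSet n) → (∀ a b → P a ≡ true → P b ≡ true → a ≡ b) → count P V ≤ 1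
  count-atMostOne P unique with count P V ≟ℕ 0
  ... | yes c≡0 = ≤-trans (≤-reflexive c≡0) z≤n
  ... | no c≢0 with count≢0⇒witness P V c≢0
  ... | a , pa = count-≤1 P a (λ u pu → unique u a pu pa)

  1≤count : ∀ (P : VSet n) {b} → P b ≡ true → 1 ≤ count P V
  1≤count P pb = count-∈ P (∈-allFin _) pb

  1≤deg : ∀ X {v w} → X w ≡ true → adj G v w ≡ true → 1 ≤ deg X v
  1≤deg X Xw a = 1≤count _ (∧-true⁺ Xw a)

  count-singleton : ∀ (P : VSet n) b → P b ≡ true → (∀ u → P u ≡ true → u ≡ b) → count P V ≡ 1
  count-singleton P b pb only-b = ≤-antisym (count-≤1 P b only-b) (1≤count P pb)

  sumOn-∈ : ∀ D (f : Fin n → ℕ) {a} → D a ≡ true → f a ≤ sumOn D f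
  sumOn-∈ D f {a} da = ≤-trans (≤-reflexive (cong (λ d → if d then f a else 0) (sym da)))
                                (sumOver-∈ (λ u → if D u then f u else 0) (∈-allFin a))

  sumOn-pair : ∀ D (f : Fin n → ℕ) {a b} → D a ≡ true → D b ≡ true → ¬ a ≡ b → f a + f b ≤ sumOn D f
  sumOn-pair D f {a} {b} da db a≢b =
    ≤-trans (≤-reflexive (cong₂ _+_ (cong (λ d → if d then f a else 0) (sym da))
                                    (cong (λ d → if d then f b else 0) (sym db))))
            (sumOver-pair (λ u → if D u then f u else 0) (∈-allFin a) (∈-allFin b) a≢b)

  sumOn-⊆ : ∀ N D (f : Fin n → ℕ) → (∀ u → N u ≡ true → D u ≡ true) → sumOn N f ≤ sumOn D f
  sumOn-⊆ N D f N⊆D = sumOver-mono V summand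
    where summand : ∀ u → (if N u then f u else 0) ≤ (if D u then f u else 0)
          summand u with N u | N⊆D u
          ... | true | d rewrite d refl = ≤-refl
          ... | false | _ = z≤n

  *-count≤sumOn : ∀ N (f : Fin n → ℕ) q → (∀ u → N u ≡ true → q ≤ f u) → q * count N V ≤ sumOn N f
  *-count≤sumOn N f q bound = go V
    where go : ∀ xs → q * count N xs ≤ sumOver (λ u → if N u then f u else 0) xs
          go [] = ≤-reflexive (*-zeroʳ q)
          go (x ∷ xs) with N x in nx
          ... | true = ≤-trans (≤-reflexive (*-suc q _)) (+-mono-≤ (bound x nx) (go xs))
          ... | false = ≤-trans (go xs) (m≤n+m _ 0)

  count-nonzero≤sumOn : ∀ N (f : Fin n → ℕ) → count (λ u → N u ∧ not (f u ≡ᵇ 0)) V ≤ sumOn N f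
  count-nonzero≤sumOn N f = go V
    where go : ∀ xs → count (λ u → N u ∧ not (f u ≡ᵇ 0)) xs ≤ sumOver (λ u → if N u then f u else 0) xs
          go [] = z≤n
          go (x ∷ xs) with N x | f x
          ... | true | zero = go xs
          ... | true | suc k = s≤s (≤-trans (go xs) (m≤n+m _ k))
          ... | false | _ = go xs

  nbhdSize≡suc-deg : ∀ X u → X u ≡ true → nbhdSize G X u ≡ suc (deg X u)
  nbhdSize≡suc-deg X u xu = begin
      count (inN G X u) V
    ≡⟨ count≡sumOver-𝟙 _ V ⟩
      sumOver (λ v → 𝟙 (inN G X u v)) V
    ≡⟨ sumOver-cong V summand ⟩
      sumOver (λ v → 𝟙 (does (v ≟ u)) + 𝟙 (X v ∧ adj G u v)) V
    ≡⟨ sumOver-+ _ _ V ⟩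
      sumOver (λ v → 𝟙 (does (v ≟ u))) V + sumOver (λ v → 𝟙 (X v ∧ adj G u v)) V
    ≡⟨ sym (cong₂ _+_ (trans (sym (count-≟ u)) (count≡sumOver-𝟙 _ V)) (count≡sumOver-𝟙 _ V)) ⟩
      suc (deg X u)
    ∎
    where
      open ≡-Reasoning
      summand : ∀ v → 𝟙 (inN G X u v) ≡ 𝟙 (does (v ≟ u)) + 𝟙 (X v ∧ adj G u v)
      summand v with v ≟ u
      ... | yes refl rewrite xu | irrefl G v = refl
      ... | no _ = refl

  deg-split : ∀ H R x → (∀ v → R v ≡ true → H v ≡ true) → deg H x ≡ deg (H ∖ R) x + deg R x
  deg-split H R x R⊆H = begin
      deg H x
    ≡⟨ deg≡sumOver H x ⟩
      sumOver (λ w → 𝟙 (H w) * 𝟙 (adj G x w)) V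
    ≡⟨ sumOver-cong V summand ⟩
      sumOver (λ w → 𝟙 ((H ∖ R) w) * 𝟙 (adj G x w) + 𝟙 (R w) * 𝟙 (adj G x w)) V
    ≡⟨ sumOver-+ _ _ V ⟩
      sumOver (λ w → 𝟙 ((H ∖ R) w) * 𝟙 (adj G x w)) V + sumOver (λ w → 𝟙 (R w) * 𝟙 (adj G x w)) V
    ≡⟨ sym (cong₂ _+_ (deg≡sumOver (H ∖ R) x) (deg≡sumOver R x)) ⟩
      deg (H ∖ R) x + deg R x
    ∎
    where
      open ≡-Reasoning
      summand : ∀ w → 𝟙 (H w) * 𝟙 (adj G x w) ≡ 𝟙 ((H ∖ R) w) * 𝟙 (adj G x w) + 𝟙 (R w) * 𝟙 (adj G x w)
      summand w = trans (cong (_* 𝟙 (adj G x w)) (𝟙-split (H w) (R w) (R⊆H w)))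
                        (*-distribʳ-+ (𝟙 (adj G x w)) (𝟙 ((H ∖ R) w)) (𝟙 (R w)))

  deg-inN : ∀ X u → deg (inN G X u) u ≡ deg X u
  deg-inN X u = count-cong V summand
    where summand : ∀ w → (inN G X u w ∧ adj G u w) ≡ (X w ∧ adj G u w)
          summand w with adj G u w | X w
          ... | true | true rewrite ∨-zeroʳ (does (w ≟ u)) = refl
          ... | true | false = refl
          ... | false | x = trans (∧-zeroʳ _) (sym (∧-zeroʳ x))

  deg≤edges : ∀ X x → X x ≡ true → deg X x ≤ edges G X
  deg≤edges X x xx = begin
      deg X x                                   ≡⟨ sym (count-cong V summand) ⟩
      deg (X ∖ Dx) x                            ≤⟨ sumOn-∈ Dx (deg (X ∖ Dx)) Dx-x ⟩
      cross Dx (X ∖ Dx)                         ≤⟨ m≤n+m _ _ ⟩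
      edges G (X ∖ Dx) + edges G Dx + cross Dx (X ∖ Dx) ≡⟨ sym (edges-split X Dx (λ _ → ∧-trueˡ)) ⟩
      edges G X                                 ∎
    where
      open ≤-Reasoning
      Dx : VSet n
      Dx v = X v ∧ does (v ≟ x)
      Dx-x : Dx x ≡ true
      Dx-x rewrite xx = dec-true (x ≟ x) refl
      summand : ∀ w → ((X ∖ Dx) w ∧ adj G x w) ≡ (X w ∧ adj G x w)
      summand w with w ≟ x | X w
      ... | yes refl | _ rewrite irrefl G w = trans (∧-zeroʳ _) (sym (∧-zeroʳ _))
      ... | no _ | true = refl
      ... | no _ | false = refl

  eM≡edges+cross : ∀ H u → eM G H u ≡ edges G (inN G H u) + cross (inN G H u) (remove G H u)
  eM≡edges+cross H u = begin
      edges G H ∸ edges G R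
    ≡⟨ cong (_∸ edges G R) (trans (edges-split H (inN G H u) (λ _ → ∧-trueˡ)) (+-assoc (edges G R) _ _)) ⟩
      edges G R + (edges G (inN G H u) + cross (inN G H u) R) ∸ edges G R
    ≡⟨ m+n∸m≡n (edges G R) _ ⟩
      edges G (inN G H u) + cross (inN G H u) R
    ∎
    where
      open ≡-Reasoning
      R = remove G H u

module Forest {n : ℕ} {G : Graph n} (forest : IsForest G) where

  no-triangle : ∀ {a b c} → ¬ a ≡ b → ¬ a ≡ c → ¬ b ≡ c →
    adj G a b ≡ true → adj G b c ≡ true → adj G c a ≡ true → ⊥
  no-triangle ab ac bc e₁ e₂ e₃ = forest (_ ∷ _ ∷ _ ∷ [])
    (((ab ∷ ac ∷ []) ∷ (bc ∷ []) ∷ [] ∷ []) , (e₁ ∷ e₂ ∷ e₃ ∷ [-]))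

  no-4-cycle : ∀ {a b c d} → ¬ a ≡ b → ¬ a ≡ c → ¬ a ≡ d → ¬ b ≡ c → ¬ b ≡ d → ¬ c ≡ d →
    adj G a b ≡ true → adj G b c ≡ true → adj G c d ≡ true → adj G d a ≡ true → ⊥
  no-4-cycle ab ac ad bc bd cd e₁ e₂ e₃ e₄ = forest (_ ∷ _ ∷ _ ∷ _ ∷ [])
    (((ab ∷ ac ∷ ad ∷ []) ∷ (bc ∷ bd ∷ []) ∷ (cd ∷ []) ∷ [] ∷ []) , (e₁ ∷ e₂ ∷ e₃ ∷ e₄ ∷ [-]))

  no-6-cycle : ∀ {a b c d e f} →
    ¬ a ≡ b → ¬ a ≡ c → ¬ a ≡ d → ¬ a ≡ e → ¬ a ≡ f →
    ¬ b ≡ c → ¬ b ≡ d → ¬ b ≡ e → ¬ b ≡ f →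
    ¬ c ≡ d → ¬ c ≡ e → ¬ c ≡ f →
    ¬ d ≡ e → ¬ d ≡ f → ¬ e ≡ f →
    adj G a b ≡ true → adj G b c ≡ true → adj G c d ≡ true →
    adj G d e ≡ true → adj G e f ≡ true → adj G f a ≡ true → ⊥
  no-6-cycle ab ac ad ae af bc bd be bf cd ce cf de df ef e₁ e₂ e₃ e₄ e₅ e₆ =
    forest (_ ∷ _ ∷ _ ∷ _ ∷ _ ∷ _ ∷ [])
      (((ab ∷ ac ∷ ad ∷ ae ∷ af ∷ []) ∷ (bc ∷ bd ∷ be ∷ bf ∷ []) ∷ (cd ∷ ce ∷ cf ∷ []) ∷
        (de ∷ df ∷ []) ∷ (ef ∷ []) ∷ [] ∷ []) ,
       (e₁ ∷ e₂ ∷ e₃ ∷ e₄ ∷ e₅ ∷ e₆ ∷ [-]))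

-- H, H′ and B are the forests F_{i-1}^D, F_i^S and F_i^D of the paper.
module Alternative {n : ℕ} (G : Graph n) (forest : IsForest G) (H : VSet n) (wS wD : Fin n)
  (wS∈H : H wS ≡ true) (wD∈H′ : remove G H wS wD ≡ true) (l p : ℕ) (1≤l : 1 ≤ l)
  (v-wD : vM G (remove G H wS) wD ≡ 1 + l) (e-wD : eM G (remove G H wS) wD ≡ l + p) where

  open Induced G
  open Forest forest

  S H′ D B Γ : VSet n
  S = inN G H wS
  H′ = remove G H wS
  D = inN G H′ wD
  B = remove G H′ wD
  Γ u = H′ u ∧ adj G wD u

  H′∩S=∅ : ∀ {v} → H′ v ≡ true → S v ≡ false
  H′∩S=∅ e = not-true⁻ (∧-trueʳ e)

  H′≢S : ∀ {v y} → H′ v ≡ true → S y ≡ true → ¬ v ≡ y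
  H′≢S H′v Sy = ≢-sym (separated S Sy (H′∩S=∅ H′v))

  wS∈S : S wS ≡ true
  wS∈S = ∈inN-centre H wS wS∈H

  S-adj-wS : ∀ {y} → S y ≡ true → ¬ y ≡ wS → adj G wS y ≡ true
  S-adj-wS e y≢wS with inN-cases H wS e
  ... | inj₁ y≡wS = ⊥-elim (y≢wS y≡wS)
  ... | inj₂ a = a

  H′-nonadj-wS : ∀ {v} → H′ v ≡ true → adj G wS v ≡ false
  H′-nonadj-wS e = ¬-not λ a → not-¬ (∈inN-adj H wS (∧-trueˡ e) a) (H′∩S=∅ e)

  H′-nbr-≢wS : ∀ {v y} → H′ v ≡ true → adj G v y ≡ true → ¬ y ≡ wS
  H′-nbr-≢wS {v} e a refl = not-¬ (trans (adj-sym G wS v) a) (H′-nonadj-wS e)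

  Γ⊆D : ∀ {u} → Γ u ≡ true → D u ≡ true
  Γ⊆D e = ∈inN-adj H′ wD (∧-trueˡ e) (∧-trueʳ e)

  Γ-≢wD : ∀ {u} → Γ u ≡ true → ¬ u ≡ wD
  Γ-≢wD e refl = not-¬ (∧-trueʳ e) (irrefl G wD)

  Γ-adj-wD : ∀ {u} → Γ u ≡ true → adj G u wD ≡ true
  Γ-adj-wD {u} e = trans (adj-sym G u wD) (∧-trueʳ e)

  D-cases : ∀ {w} → D w ≡ true → w ≡ wD ⊎ Γ w ≡ true
  D-cases e with inN-cases H′ wD e
  ... | inj₁ w≡wD = inj₁ w≡wD
  ... | inj₂ a = inj₂ (∧-true⁺ (∧-trueˡ e) a)

  Γ-independent : ∀ {u w} → Γ u ≡ true → Γ w ≡ true → adj G u w ≡ true → ⊥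
  Γ-independent {u} Γu Γw a =
    no-triangle (λ { refl → not-¬ a (irrefl G u) }) (Γ-≢wD Γu) (Γ-≢wD Γw) a (Γ-adj-wD Γw) (∧-trueʳ Γu)

  count-Γ : count Γ V ≡ l
  count-Γ = suc-injective (trans (sym (nbhdSize≡suc-deg H′ wD wD∈H′)) v-wD)

  sumOn-Γ≤p : sumOn Γ (deg B) ≤ p
  sumOn-Γ≤p = ≤-trans (sumOn-⊆ Γ D (deg B) (λ _ → Γ⊆D)) cross≤p
    where
      l≤edges : l ≤ edges G D
      l≤edges = ≤-trans (≤-reflexive (sym (trans (deg-inN H′ wD) count-Γ))) (deg≤edges D wD (∈inN-centre H′ wD wD∈H′))
      cross≤p : cross D B ≤ p
      cross≤p = +-cancelˡ-≤ l _ _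
        (≤-trans (+-monoˡ-≤ (cross D B) l≤edges) (≤-reflexive (trans (sym (eM≡edges+cross H′ wD)) e-wD)))

  Γ-inhabited : Σ (Fin n) λ b → Γ b ≡ true
  Γ-inhabited = count≢0⇒witness Γ V (λ c≡0 → <⇒≢ 1≤l (sym (trans (sym count-Γ) c≡0)))

  x : Fin n
  x = argmin (deg B) (proj₁ Γ-inhabited) (filter (λ u → Γ u ≟𝔹 true) V)

  x∈Γ : Γ x ≡ true
  x∈Γ = argmin-all (deg B) (proj₂ Γ-inhabited) (all-filter (λ u → Γ u ≟𝔹 true) V)

  x-minimal : ∀ {u} → Γ u ≡ true → deg B x ≤ deg B u
  x-minimal {u} Γu = All.lookup (f[argmin]≤f[xs] (proj₁ Γ-inhabited) _)
                                 (∈-filter⁺ (λ u → Γ u ≟𝔹 true) (∈-allFin u) Γu)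

  q : ℕ
  q = deg B x

  instance
    l-nonZero : NonZero l
    l-nonZero = >-nonZero 1≤l

  q≤p/l : q ≤ p / l
  q≤p/l = ≤-trans (≤-reflexive (sym (m*n/n≡m q l))) (/-monoˡ-≤ l q*l≤p)
    where
      q*l≤p : q * l ≤ p
      q*l≤p = ≤-trans (≤-reflexive (cong (q *_) (sym count-Γ)))
                (≤-trans (*-count≤sumOn Γ (deg B) q (λ _ → x-minimal)) sumOn-Γ≤p)

  x∈H′ : H′ x ≡ true
  x∈H′ = ∧-trueˡ x∈Γ

  x∈H : H x ≡ true
  x∈H = ∧-trueˡ x∈H′

  deg-H-x : deg H x ≡ q + 1 + deg S x
  deg-H-x = trans (deg-split H S x (λ _ → ∧-trueˡ))
                  (cong (_+ deg S x) (trans (deg-split H′ D x (λ _ → ∧-trueˡ)) (cong (_+_ q) deg-D-x)))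
    where
      deg-D-x : deg D x ≡ 1
      deg-D-x = count-singleton _ wD (∧-true⁺ (∈inN-centre H′ wD wD∈H′) (Γ-adj-wD x∈Γ)) only-wD
        where only-wD : ∀ w → (D w ∧ adj G x w) ≡ true → w ≡ wD
              only-wD w e with D-cases (∧-trueˡ e)
              ... | inj₁ w≡wD = w≡wD
              ... | inj₂ Γw = ⊥-elim (Γ-independent x∈Γ Γw (∧-trueʳ e))

  deg-S≤1 : ∀ {u} → H′ u ≡ true → deg S u ≤ 1
  deg-S≤1 {u} H′u = count-atMostOne _ unique
    where
      unique : ∀ a b → (S a ∧ adj G u a) ≡ true → (S b ∧ adj G u b) ≡ true → a ≡ b
      unique a b ea eb with a ≟ b
      ... | yes a≡b = a≡b
      ... | no a≢b = ⊥-elim (no-4-cycle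
        (H′≢S H′u Sa) (H′≢S H′u wS∈S) (H′≢S H′u Sb)
        a≢wS a≢b (≢-sym b≢wS)
        (∧-trueʳ ea) (trans (adj-sym G a wS) (S-adj-wS Sa a≢wS)) (S-adj-wS Sb b≢wS)
        (trans (adj-sym G b u) (∧-trueʳ eb)))
        where
          Sa = ∧-trueˡ ea
          Sb = ∧-trueˡ eb
          a≢wS = H′-nbr-≢wS H′u (∧-trueʳ ea)
          b≢wS = H′-nbr-≢wS H′u (∧-trueʳ eb)

  S-touch-unique : ∀ {u u′ y y′} → Γ u ≡ true → Γ u′ ≡ true → ¬ u ≡ u′ →
    S y ≡ true → adj G u y ≡ true → S y′ ≡ true → adj G u′ y′ ≡ true → ⊥
  S-touch-unique {u} {u′} {y} {y′} Γu Γu′ u≢u′ Sy uy Sy′ u′y′ with y ≟ y′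
  ... | yes refl = no-4-cycle
          (H′≢S H′u Sy) u≢u′ (Γ-≢wD Γu) (≢-sym (H′≢S H′u′ Sy)) (≢-sym (H′≢S wD∈H′ Sy)) (Γ-≢wD Γu′)
          uy (trans (adj-sym G y u′) u′y′) (Γ-adj-wD Γu′) (∧-trueʳ Γu)
    where H′u = ∧-trueˡ Γu
          H′u′ = ∧-trueˡ Γu′
  ... | no y≢y′ = no-6-cycle
          (H′≢S H′u Sy) (H′≢S H′u wS∈S) (H′≢S H′u Sy′) u≢u′ (Γ-≢wD Γu)
          y≢wS y≢y′ (≢-sym (H′≢S H′u′ Sy)) (≢-sym (H′≢S wD∈H′ Sy))
          (≢-sym y′≢wS) (≢-sym (H′≢S H′u′ wS∈S)) (≢-sym (H′≢S wD∈H′ wS∈S))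
          (≢-sym (H′≢S H′u′ Sy′)) (≢-sym (H′≢S wD∈H′ Sy′)) (Γ-≢wD Γu′)
          uy (trans (adj-sym G y wS) (S-adj-wS Sy y≢wS)) (S-adj-wS Sy′ y′≢wS)
          (trans (adj-sym G y′ u′) u′y′) (Γ-adj-wD Γu′) (∧-trueʳ Γu)
    where H′u = ∧-trueˡ Γu
          H′u′ = ∧-trueˡ Γu′
          y≢wS = H′-nbr-≢wS H′u uy
          y′≢wS = H′-nbr-≢wS H′u′ u′y′

  Rx Dx : VSet n
  Rx = remove G H x
  Dx = inN G H x

  wD∈Dx : Dx wD ≡ true
  wD∈Dx = ∈inN-adj H x (∧-trueˡ wD∈H′) (Γ-adj-wD x∈Γ)

  deg-H-x+cross≤eM : deg H x + cross Dx Rx ≤ eM G H x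
  deg-H-x+cross≤eM = ≤-trans (+-monoˡ-≤ (cross Dx Rx) deg≤edges-Dx) (≤-reflexive (sym (eM≡edges+cross H x)))
    where deg≤edges-Dx : deg H x ≤ edges G Dx
          deg≤edges-Dx = ≤-trans (≤-reflexive (sym (deg-inN H x))) (deg≤edges Dx x (∈inN-centre H x x∈H))

  l≤1+deg-Rx-wD : l ≤ suc (deg Rx wD)
  l≤1+deg-Rx-wD =
    ≤-trans (≤-reflexive (trans (sym count-Γ) (count-split Γ (λ u → does (u ≟ x)) V)))
            (+-mono-≤ (count-≤1 _ x (λ u e → dec-true⁻ (u ≟ x) (∧-trueʳ {Γ u} e))) (count-mono V Γ∖x⊆Rx))
    where
      Γ∖x⊆Rx : ∀ w → (Γ w ∧ not (does (w ≟ x))) ≡ true → (Rx w ∧ adj G wD w) ≡ true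
      Γ∖x⊆Rx w e = ∧-true⁺ (∈remove H x (∧-trueˡ (∧-trueˡ Γw)) w≢x (¬-not (Γ-independent x∈Γ Γw)))
                           (∧-trueʳ Γw)
        where Γw = ∧-trueˡ e
              w≢x : ¬ w ≡ x
              w≢x w≡x = not-¬ (dec-true (w ≟ x) w≡x) (not-true⁻ (∧-trueʳ {Γ w} e))

  isolated-H⇒isolated-Rx : ∀ v → isolated G H v ≡ true → isolated G Rx v ≡ true
  isolated-H⇒isolated-Rx v e =
    ∧-true⁺ v∈Rx (≡ᵇ0⁺ (n≤0⇒n≡0 (≤-trans (deg-mono Rx H v (λ _ → ∧-trueˡ)) (≤-reflexive deg-H-v≡0))))
    where
      deg-H-v≡0 : deg H v ≡ 0
      deg-H-v≡0 = ≡ᵇ0⁻ (∧-trueʳ {H v} e)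
      no-nbr : ∀ {w} → H w ≡ true → adj G v w ≡ true → ⊥
      no-nbr Hw a = n≮0 (subst (1 ≤_) deg-H-v≡0 (1≤deg H Hw a))
      v∈Rx : Rx v ≡ true
      v∈Rx = ∈remove H x (∧-trueˡ e) (λ { refl → no-nbr (∧-trueˡ wD∈H′) (Γ-adj-wD x∈Γ) })
                         (¬-not λ a → no-nbr x∈H (trans (adj-sym G v x) a))

  -- The vertices of L become isolated when x is played; the other leaves (Bad) lie in {x} ∪ touch.
  leaf away L Bad touch : VSet n
  leaf u = Γ u ∧ (deg B u ≡ᵇ 0)
  away u = not (does (u ≟ x)) ∧ (deg S u ≡ᵇ 0)
  L u = leaf u ∧ away u
  Bad u = leaf u ∧ not (away u)
  touch u = Γ u ∧ not (deg S u ≡ᵇ 0)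

  L⇒isolated-Rx : ∀ {u} → L u ≡ true → isolated G Rx u ≡ true
  L⇒isolated-Rx {u} e = ∧-true⁺ u∈Rx (≡ᵇ0⁺ (trans (count-cong V no-nbr) (count-const-false V)))
    where
      Γu = ∧-trueˡ (∧-trueˡ {leaf u} e)
      deg-B-u≡0 : deg B u ≡ 0
      deg-B-u≡0 = ≡ᵇ0⁻ (∧-trueʳ {Γ u} (∧-trueˡ {leaf u} e))
      deg-S-u≡0 : deg S u ≡ 0
      deg-S-u≡0 = ≡ᵇ0⁻ (∧-trueʳ {not (does (u ≟ x))} (∧-trueʳ {leaf u} e))
      u≢x : ¬ u ≡ x
      u≢x u≡x = not-¬ (dec-true (u ≟ x) u≡x) (not-true⁻ (∧-trueˡ (∧-trueʳ {leaf u} e)))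
      u∈Rx : Rx u ≡ true
      u∈Rx = ∈remove H x (∧-trueˡ (∧-trueˡ Γu)) u≢x (¬-not (Γ-independent x∈Γ Γu))
      excluded : ∀ {w} → Rx w ≡ true → adj G u w ≡ true → ⊥
      excluded {w} Rxw a with S w in Sw
      ... | true = not-¬ (∧-true⁺ Sw a) (count≡0⇒false _ deg-S-u≡0 (∈-allFin w))
      ... | false with D w in Dw
      ...   | true with D-cases Dw
      ...     | inj₁ refl = not-¬ Rxw (∉remove H x wD∈Dx)
      ...     | inj₂ Γw = Γ-independent Γu Γw a
      excluded {w} Rxw a | false | false =
        not-¬ (∧-true⁺ (∧-true⁺ (∧-true⁺ (∧-trueˡ Rxw) (cong not Sw)) (cong not Dw)) a)
                   (count≡0⇒false _ deg-B-u≡0 (∈-allFin w))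
      no-nbr : ∀ w → (Rx w ∧ adj G u w) ≡ false
      no-nbr w = ¬-not λ e′ → excluded (∧-trueˡ e′) (∧-trueʳ {Rx w} e′)

  L⇒not-isolated-H : ∀ {u} → L u ≡ true → isolated G H u ≡ false
  L⇒not-isolated-H {u} e
    rewrite ≡ᵇ0-false (1≤deg H (∧-trueˡ wD∈H′) (Γ-adj-wD (∧-trueˡ (∧-trueˡ {leaf u} e)))) = ∧-zeroʳ (H u)

  K-H+L≤K-Rx : K G H + count L V ≤ K G Rx
  K-H+L≤K-Rx =
    ≤-trans (+-mono-≤ (count-mono V (λ v e → ∧-true⁺ (isolated-H⇒isolated-Rx v e) e))
                      (count-mono V (λ u e → ∧-true⁺ (L⇒isolated-Rx e) (cong not (L⇒not-isolated-H e)))))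
            (≤-reflexive (sym (count-split (isolated G Rx) (isolated G H) V)))

  l≤p+L+Bad : l ≤ p + (count L V + count Bad V)
  l≤p+L+Bad = begin
      l                                        ≡⟨ sym count-Γ ⟩
      count Γ V                                ≡⟨ count-split Γ (λ u → deg B u ≡ᵇ 0) V ⟩
      count leaf V + count nonzero V           ≡⟨ +-comm (count leaf V) _ ⟩
      count nonzero V + count leaf V           ≤⟨ +-monoˡ-≤ _ (≤-trans (count-nonzero≤sumOn Γ (deg B)) sumOn-Γ≤p) ⟩
      p + count leaf V                         ≡⟨ cong (_+_ p) (count-split leaf away V) ⟩
      p + (count L V + count Bad V)            ∎
    where
      open ≤-Reasoning
      nonzero : VSet n
      nonzero u = Γ u ∧ not (deg B u ≡ᵇ 0)

  touch⇒S-nbr : ∀ {u} → touch u ≡ true → Σ (Fin n) λ y → (S y ∧ adj G u y) ≡ true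
  touch⇒S-nbr {u} e = count≢0⇒witness _ V λ deg≡0 → not-¬ (≡ᵇ0⁺ deg≡0) (not-true⁻ (∧-trueʳ {Γ u} e))

  touch-unique : ∀ a b → touch a ≡ true → touch b ≡ true → a ≡ b
  touch-unique a b ta tb with a ≟ b | touch⇒S-nbr ta | touch⇒S-nbr tb
  ... | yes a≡b | _ | _ = a≡b
  ... | no a≢b | ya , ea | yb , eb =
    ⊥-elim (S-touch-unique (∧-trueˡ ta) (∧-trueˡ tb) a≢b (∧-trueˡ ea) (∧-trueʳ {S ya} ea) (∧-trueˡ eb) (∧-trueʳ {S yb} eb))

  Bad-cases : ∀ {u} → Bad u ≡ true → u ≡ x ⊎ touch u ≡ true
  Bad-cases {u} e with u ≟ x | deg S u ≡ᵇ 0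
  ... | yes u≡x | _ = inj₁ u≡x
  ... | no _ | false = inj₂ (∧-true⁺ (∧-trueˡ (∧-trueˡ {leaf u} e)) refl)
  ... | no _ | true with ∧-trueʳ {leaf u} e
  ...   | ()

  Bad≤2 : count Bad V ≤ 2
  Bad≤2 = ≤-trans (count-mono V Bad⊆x∪touch)
            (≤-trans (count-∨ _ touch V)
              (+-mono-≤ (count-≤1 _ x (λ u e → dec-true⁻ (u ≟ x) e)) (count-atMostOne touch touch-unique)))
    where Bad⊆x∪touch : ∀ u → Bad u ≡ true → (does (u ≟ x) ∨ touch u) ≡ true
          Bad⊆x∪touch u e with Bad-cases e
          ... | inj₁ u≡x rewrite dec-true (u ≟ x) u≡x = refl
          ... | inj₂ tu rewrite tu = ∨-zeroʳ _

  Bad≤1 : touch x ≡ true → count Bad V ≤ 1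
  Bad≤1 tx = count-≤1 Bad x only-x
    where only-x : ∀ u → Bad u ≡ true → u ≡ x
          only-x u e with Bad-cases e
          ... | inj₁ u≡x = u≡x
          ... | inj₂ tu = touch-unique u x tu tx

  kM-x≥ : ∀ c → count Bad V ≤ c → kM G H x ℤ.≥ + l ℤ.- + p ℤ.- + c
  kM-x≥ c Bad≤c = ℤ-rearrange (K G Rx) (K G H) l p c (begin
      K G H + l                         ≤⟨ +-monoʳ-≤ (K G H) (≤-trans l≤p+L+Bad (+-monoʳ-≤ p (+-monoʳ-≤ (count L V) Bad≤c))) ⟩
      K G H + (p + (count L V + c))     ≡⟨ rearrange (K G H) p (count L V) c ⟩
      K G H + count L V + p + c         ≤⟨ +-monoˡ-≤ c (+-monoˡ-≤ p K-H+L≤K-Rx) ⟩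
      K G Rx + p + c                    ∎)
    where
      open ≤-Reasoning
      rearrange : ∀ k p m c → k + (p + (m + c)) ≡ k + m + p + c
      rearrange = solve-∀

  move : Σ (Fin n) λ ŵ → (ŵ ∈V H) ×
      Σ ℕ λ q → (q ≤ (p / l) {{>-nonZero 1≤l}}) ×
        ((vM G H ŵ ≡ q + 2 × eM G H ŵ ≥ q + l × kM G H ŵ ℤ.≥ + l ℤ.- + p ℤ.- + 2)
        ⊎
         (vM G H ŵ ≡ q + 3 × eM G H ŵ ≥ q + l + 2 × kM G H ŵ ℤ.≥ + l ℤ.- + p ℤ.- + 1))
  move with deg S x ≟ℕ 0
  ... | yes deg-S-x≡0 = x , x∈H , q , q≤p/l , inj₁ (v-x , e-x , kM-x≥ 2 Bad≤2)
    where
      deg-H-x≡ : deg H x ≡ q + 1 + 0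
      deg-H-x≡ = trans deg-H-x (cong (_+_ (q + 1)) deg-S-x≡0)
      v-x : vM G H x ≡ q + 2
      v-x = trans (nbhdSize≡suc-deg H x x∈H) (trans (cong suc deg-H-x≡) (lemma q))
        where lemma : ∀ q → suc (q + 1 + 0) ≡ q + 2
              lemma = solve-∀
      e-x : q + l ≤ eM G H x
      e-x = begin
        q + l                        ≤⟨ +-monoʳ-≤ q l≤1+deg-Rx-wD ⟩
        q + suc (deg Rx wD)          ≡⟨ lemma q (deg Rx wD) ⟩
        q + 1 + 0 + deg Rx wD        ≡⟨ cong (_+ deg Rx wD) (sym deg-H-x≡) ⟩
        deg H x + deg Rx wD          ≤⟨ +-monoʳ-≤ (deg H x) (sumOn-∈ Dx (deg Rx) wD∈Dx) ⟩
        deg H x + cross Dx Rx        ≤⟨ deg-H-x+cross≤eM ⟩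
        eM G H x                     ∎
        where
          open ≤-Reasoning
          lemma : ∀ q d → q + suc d ≡ q + 1 + 0 + d
          lemma = solve-∀
  ... | no deg-S-x≢0 = x , x∈H , q , q≤p/l , inj₂ (v-x , e-x , kM-x≥ 1 (Bad≤1 touch-x))
    where
      touch-x : touch x ≡ true
      touch-x = ∧-true⁺ x∈Γ (cong not (≡ᵇ0-false (n≢0⇒n>0 deg-S-x≢0)))
      deg-H-x≡ : deg H x ≡ q + 1 + 1
      deg-H-x≡ = trans deg-H-x (cong (_+_ (q + 1)) (≤-antisym (deg-S≤1 x∈H′) (n≢0⇒n>0 deg-S-x≢0)))
      v-x : vM G H x ≡ q + 3
      v-x = trans (nbhdSize≡suc-deg H x x∈H) (trans (cong suc deg-H-x≡) (lemma q))
        where lemma : ∀ q → suc (q + 1 + 1) ≡ q + 3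
              lemma = solve-∀
      y : Fin n
      y = proj₁ (touch⇒S-nbr touch-x)
      Sy : S y ≡ true
      Sy = ∧-trueˡ (proj₂ (touch⇒S-nbr touch-x))
      xy : adj G x y ≡ true
      xy = ∧-trueʳ {S y} (proj₂ (touch⇒S-nbr touch-x))
      1≤deg-Rx-y : 1 ≤ deg Rx y
      1≤deg-Rx-y = 1≤deg Rx (∈remove H x wS∈H (≢-sym (H′≢S x∈H′ wS∈S)) (trans (adj-sym G x wS) (H′-nonadj-wS x∈H′)))
                            (trans (adj-sym G y wS) (S-adj-wS Sy (H′-nbr-≢wS x∈H′ xy)))
      e-x : q + l + 2 ≤ eM G H x
      e-x = begin
        q + l + 2                                  ≤⟨ +-mono-≤ (+-monoʳ-≤ q l≤1+deg-Rx-wD) (s≤s 1≤deg-Rx-y) ⟩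
        q + suc (deg Rx wD) + suc (deg Rx y)       ≡⟨ lemma q (deg Rx wD) (deg Rx y) ⟩
        q + 1 + 1 + (deg Rx wD + deg Rx y)         ≡⟨ cong (_+ (deg Rx wD + deg Rx y)) (sym deg-H-x≡) ⟩
        deg H x + (deg Rx wD + deg Rx y)           ≤⟨ +-monoʳ-≤ (deg H x) (sumOn-pair Dx (deg Rx) wD∈Dx y∈Dx (H′≢S wD∈H′ Sy)) ⟩
        deg H x + cross Dx Rx                      ≤⟨ deg-H-x+cross≤eM ⟩
        eM G H x                                   ∎
        where
          open ≤-Reasoning
          y∈Dx : Dx y ≡ true
          y∈Dx = ∈inN-adj H x (∧-trueˡ Sy) xy
          lemma : ∀ q d e → q + suc d + suc e ≡ q + 1 + 1 + (d + e)
          lemma = solve-∀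

swellerTurn-after : ∀ {n} (G : Graph n) k (pre : List (Fin n)) H rest → length pre ≡ 2 * k →
  SwellerTurn G H (pre ++ rest) → SwellerTurn G (playAll G H pre) rest
swellerTurn-after G zero [] H rest _ turn = turn
swellerTurn-after G (suc k) (a ∷ []) H rest len _ with trans (suc-injective len) (+-suc k (k + 0))
... | ()
swellerTurn-after G (suc k) (a ∷ b ∷ pre) H rest len (s-move _ _ (d-move _ turn)) =
  swellerTurn-after G k pre (remove G (remove G H a) b) rest
    (suc-injective (trans (suc-injective len) (+-suc k (k + 0)))) turn

lemma2 : ∀ {n} (F : Graph n) → IsForest F →
    (ws : List (Fin n)) → GreedyPlay F ws →
    (i : ℕ) → 1 ≤ i → i ≤ ⌊ length ws /2⌋ →
    (pre : List (Fin n)) (wS wD : Fin n) (suf : List (Fin n)) →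
    ws ≡ pre ++ (wS ∷ wD ∷ suf) → length pre ≡ 2 * (i ∸ 1) →
    (l p : ℕ) (1≤l : 1 ≤ l) →
    vM F (remove F (playAll F full pre) wS) wD ≡ 1 + l →
    eM F (remove F (playAll F full pre) wS) wD ≡ l + p →
    Σ (Fin n) λ ŵ → (ŵ ∈V playAll F full pre) ×
      Σ ℕ λ q → (q ≤ (p / l) {{>-nonZero 1≤l}}) ×
        ((vM F (playAll F full pre) ŵ ≡ q + 2 ×
          eM F (playAll F full pre) ŵ ≥ q + l ×
          kM F (playAll F full pre) ŵ ℤ.≥ + l ℤ.- + p ℤ.- + 2)
        ⊎
         (vM F (playAll F full pre) ŵ ≡ q + 3 ×
          eM F (playAll F full pre) ŵ ≥ q + l + 2 ×
          kM F (playAll F full pre) ŵ ℤ.≥ + l ℤ.- + p ℤ.- + 1))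
lemma2 F forest ws play i _ _ pre wS wD suf refl len l p 1≤l v-wD e-wD
  with swellerTurn-after F (i ∸ 1) pre full (wS ∷ wD ∷ suf) len play
... | s-move wS∈H _ (d-move wD∈H′ _) =
  Alternative.move F forest (playAll F full pre) wS wD wS∈H wD∈H′ l p 1≤l v-wD e-wD
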